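{- Let $K=\mathbb{Q}(\sqrt{ -3})$, $\mathcal{O}_K=\mathbb{Z}[\tfrac{1+\sqrt{ -3}}{2}]$, and $\mathfrak{f}=4\sqrt{ -3}\,\mathcal{O}_K$. For a nonzero ideal $\mathfrak{a}$ of $\mathcal{O}_K$ coprime to $\mathfrak{f}$, let $\alpha$ be its unique generator of the form $\alpha=x+y\sqrt{ -3}$ with $x,y\in\mathbb{Z}$, $x+y\equiv 1\pmod 2$, $x\equiv 1\pmod 3$, and set $c_{\pm}(\mathfrak{a})=(-1)^{(x\mp y-1)/2}\alpha^6$; set $c_\pm(\mathfrak{a})=0$ if $\mathfrak{a}$ is not coprime to $\mathfrak{f}$. For $n\ge1$ let $a_\pm(n)=\sum_{\mathrm{Norm}(\mathfrak{a})=n}c_\pm(\mathfrak{a})$, the sum over nonzero ideals of norm $n$; these are the Fourier coefficients of the normalised Hecke eigenforms $\varphi_{K,c_\pm}\in S_7(\Gamma_1(144),\chi)$, where $\chi(n)=(-1)^{(n-1)/2}$ if $\gcd(n,144)=1$ and $\chi(n)=0$ otherwise. If $p$ is a prime with $p\equiv 5$ or $11\pmod{12}$ and $j\ge0$ is an integer, then $a_+(p^j)=a_-(p^j)\equiv 1\pmod 2$ if $j$ is even, and $a_+(p^j)=a_-(p^j)=0$ if $j$ is odd. -}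

module Defs where

open import Data.Bool.Base using (Bool; true; false; _∧_; if_then_else_)
open import Data.Nat.Base as ℕ using (ℕ; zero; suc)
open import Data.Integer.Base as ℤ using (ℤ; +_; ∣_∣; _%ℕ_; _/ℕ_)
open import Data.Integer.Properties using () renaming (_≟_ to _≟ℤ_)
open import Data.Nat.Properties using () renaming (_≟_ to _≟ℕ_)
open import Data.List.Base using (List; []; _∷_; map; upTo; concatMap; filterᵇ; foldr)
open import Data.Product.Base using (_×_; _,_; ∃)
open import Relation.Nullary.Decidable using (⌊_⌋)
open import Relation.Binary.PropositionalEquality using (_≡_)

-- The ring of integers O_K = ℤ[ω] of K = ℚ(√-3), ω = (1 + √-3)/2,
-- ω² = ω - 1.  An element  a + b ω  is represented by  mk a b.

record 𝒪K : Set where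
  constructor mk
  field
    re : ℤ
    om : ℤ
open 𝒪K public

infixl 6 _+K_ _-K_
infixl 7 _*K_
infixr 8 _^K_

_+K_ : 𝒪K → 𝒪K → 𝒪K
mk a b +K mk c d = mk (a ℤ.+ c) (b ℤ.+ d)

_-K_ : 𝒪K → 𝒪K → 𝒪K
mk a b -K mk c d = mk (a ℤ.- c) (b ℤ.- d)

-- (a + bω)(c + dω) = (ac - bd) + (ad + bc + bd) ω   since ω² = ω - 1
_*K_ : 𝒪K → 𝒪K → 𝒪K
mk a b *K mk c d = mk (a ℤ.* c ℤ.- b ℤ.* d) (a ℤ.* d ℤ.+ b ℤ.* c ℤ.+ b ℤ.* d)

0K 1K 2K : 𝒪K
0K = mk (+ 0) (+ 0)
1K = mk (+ 1) (+ 0)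
2K = mk (+ 2) (+ 0)

_^K_ : 𝒪K → ℕ → 𝒪K
x ^K zero  = 1K
x ^K suc n = x *K (x ^K n)

ι : ℤ → 𝒪K
ι z = mk z (+ 0)

-- the element x + y √-3 of O_K  (√-3 = 2ω - 1)
sqrt-3-form : ℤ → ℤ → 𝒪K
sqrt-3-form x y = mk (x ℤ.- y) (+ 2 ℤ.* y)

_≡_mod2 : 𝒪K → 𝒪K → Set
u ≡ v mod2 = ∃ λ (γ : 𝒪K) → u -K v ≡ 2K *K γ

altℕ : ℕ → ℤ
altℕ zero    = + 1
altℕ (suc n) = ℤ.- altℕ n

negOnePow : ℤ → ℤ
negOnePow m = altℕ ∣ m ∣

data PM : Set where
  plus minus : PM

normalisedᵇ : ℤ → ℤ → Bool
normalisedᵇ x y = ⌊ (x ℤ.+ y) %ℕ 2 ≟ℕ 1 ⌋ ∧ ⌊ x %ℕ 3 ≟ℕ 1 ⌋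

-- c_±(𝔞) = (-1)^((x ∓ y - 1)/2) α⁶  for the normalised generator α = x + y√-3
-- ((x ∓ y - 1) is even, so /ℕ 2 is exact division)
c : PM → ℤ → ℤ → 𝒪K
c plus  x y = ι (negOnePow ((x ℤ.- y ℤ.- + 1) /ℕ 2)) *K (sqrt-3-form x y ^K 6)
c minus x y = ι (negOnePow ((x ℤ.+ y ℤ.- + 1) /ℕ 2)) *K (sqrt-3-form x y ^K 6)

range : ℕ → List ℤ
range n = map (λ k → + k ℤ.- + n) (upTo (suc (2 ℕ.* n)))

-- These are in bijection with the nonzero ideals 𝔞 of O_K of norm n
-- that are coprime to 𝔣 = 4√-3 O_K (each such ideal has a unique
-- normalised generator; ideals not coprime to 𝔣 have none).
normGens : ℕ → List (ℤ × ℤ)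
normGens n =
  filterᵇ (λ { (x , y) → ⌊ x ℤ.* x ℤ.+ + 3 ℤ.* (y ℤ.* y) ≟ℤ + n ⌋ ∧ normalisedᵇ x y })
    (concatMap (λ x → map (λ y → (x , y)) (range n)) (range n))

sumK : List 𝒪K → 𝒪K
sumK = foldr _+K_ 0K

a : PM → ℕ → 𝒪K
a s n = sumK (map (λ { (x , y) → c s x y }) (normGens n))

-- A prime p ≡ 5, 11 (mod 12) satisfies p ≡ 5 (mod 6), so p = 3m + 2 and cubing is injective
-- modulo p: by Fermat, A ≡ A^(2p-1) = (A³)^(2m+1). As (x - 3y)(x² + 3y²) = (x - y)³ - (2y)³,
-- p ∣ x² + 3y² forces p ∣ x - 3y, hence p ∣ 12y², and since p ≥ 5 this gives p ∣ y and p ∣ x.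
-- By descent, x² + 3y² = p^j then has no solution for odd j, and only y = 0, x = ±p^(j/2) for
-- even j, where exactly one sign (x ≡ 1 mod 6) is normalised. So a±(p^j) is an empty sum for
-- odd j, and for even j the single term (±1)·x⁶, which is the same for both characters and odd.
module Submission where

module Fermat where

  open import Data.Nat.Base using (ℕ; zero; suc; _+_; _*_; _^_; _∸_; _!; _<_; _≤_; z≤n; s≤s; NonZero; >-nonZero⁻¹; nonTrivial⇒n>1)
  open import Data.Nat.Properties using (n<1+n; n≤1+n; <-trans; ≤-trans; ≤-refl; <⇒≤; ∸-monoʳ-<; *-zeroʳ; +-identityʳ; _!*_!≢0)
  open import Data.Nat.Combinatorics using (_C_; nCn≡1; k>n⇒nCk≡0; nCk+nC[k+1]≡[n+1]C[k+1]; nCk≡n!/k![n-k]!; k![n∸k]!∣n!)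
  open import Data.Nat.DivMod using (_/_)
  open import Data.Nat.Divisibility using (_∣_; divides; quotient; >⇒∤; m∣n⇒n≡quotient*m; n/m≡quotient; m∣m*n)
  open import Data.Nat.Primality using (Prime; euclidsLemma; prime⇒nonZero; prime⇒nonTrivial)
  open import Data.Nat.Tactic.RingSolver using (solve-∀)
  open import Data.Product.Base using (∃-syntax; _,_)
  open import Data.Sum.Base using (inj₁; inj₂)
  open import Relation.Nullary.Negation using (¬_; contradiction)
  open import Relation.Binary.PropositionalEquality using (_≡_; refl; sym; cong; cong₂; subst; module ≡-Reasoning)

  n!≡nCk*[k!*[n∸k]!] : ∀ {n k} → k ≤ n → n ! ≡ (n C k) * (k ! * (n ∸ k) !)
  n!≡nCk*[k!*[n∸k]!] {n} {k} k≤n = begin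
    n !                ≡⟨ m∣n⇒n≡quotient*m d∣n! ⟩
    quotient d∣n! * d  ≡⟨ cong (_* d) (n/m≡quotient d∣n!) ⟨
    n ! / d * d        ≡⟨ cong (_* d) (nCk≡n!/k![n-k]! k≤n) ⟨
    (n C k) * d        ∎
    where
    open ≡-Reasoning
    instance _ = k !* (n ∸ k) !≢0
    d = k ! * (n ∸ k) !
    d∣n! = k![n∸k]!∣n! k≤n

  n∣n! : ∀ {n} .{{_ : NonZero n}} → n ∣ n !
  n∣n! {suc n} = m∣m*n (n !)

  0^n≡0 : ∀ n .{{_ : NonZero n}} → 0 ^ n ≡ 0
  0^n≡0 (suc n) = refl

  binomialSum : ℕ → ℕ → ℕ → ℕ
  binomialSum n a zero    = 0
  binomialSum n a (suc m) = binomialSum n a m + (n C m) * a ^ m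

  binomialSum-pascal : ∀ n a m →
    binomialSum (suc n) a (suc m) ≡ binomialSum n a (suc m) + a * binomialSum n a m
  binomialSum-pascal n a zero    = cong (1 +_) (sym (*-zeroʳ a))
  binomialSum-pascal n a (suc m) = begin
    binomialSum (suc n) a (suc m) + (suc n C suc m) * a ^ suc m
      ≡⟨ cong₂ (λ s c → s + c * a ^ suc m) (binomialSum-pascal n a m) (sym (nCk+nC[k+1]≡[n+1]C[k+1] n m)) ⟩
    (S₁ + a * S₀) + ((n C m) + (n C suc m)) * (a * a ^ m)
      ≡⟨ regroup S₁ S₀ (n C m) (n C suc m) a (a ^ m) ⟩
    (S₁ + (n C suc m) * a ^ suc m) + a * (S₀ + (n C m) * a ^ m) ∎
    where
    open ≡-Reasoning
    S₀ = binomialSum n a m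
    S₁ = binomialSum n a (suc m)
    regroup : ∀ s₁ s₀ c₀ c₁ a b → (s₁ + a * s₀) + (c₀ + c₁) * (a * b) ≡ (s₁ + c₁ * (a * b)) + a * (s₀ + c₀ * b)
    regroup = solve-∀

  binomialSum-complete : ∀ n a → binomialSum n a (suc (suc n)) ≡ binomialSum n a (suc n)
  binomialSum-complete n a = begin
    binomialSum n a (suc n) + (n C suc n) * a ^ suc n  ≡⟨ cong (λ c → binomialSum n a (suc n) + c * a ^ suc n) (k>n⇒nCk≡0 (n<1+n n)) ⟩
    binomialSum n a (suc n) + 0                        ≡⟨ +-identityʳ _ ⟩
    binomialSum n a (suc n)                            ∎
    where open ≡-Reasoning

  binomial-theorem : ∀ n a → suc a ^ n ≡ binomialSum n a (suc n)
  binomial-theorem zero    a = refl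
  binomial-theorem (suc n) a = begin
    suc a * suc a ^ n                                            ≡⟨ cong (suc a *_) (binomial-theorem n a) ⟩
    suc a * binomialSum n a (suc n)                              ≡⟨ cong (_+ a * binomialSum n a (suc n)) (binomialSum-complete n a) ⟨
    binomialSum n a (suc (suc n)) + a * binomialSum n a (suc n)  ≡⟨ binomialSum-pascal n a (suc n) ⟨
    binomialSum (suc n) a (suc (suc n))                          ∎
    where open ≡-Reasoning

  module _ {p : ℕ} (p-prime : Prime p) where

    private instance
      p≢0 = prime⇒nonZero p-prime
      p>1 = prime⇒nonTrivial p-prime

    prime∤! : ∀ {m} → m < p → ¬ p ∣ m !
    prime∤! {zero}  _   = >⇒∤ (nonTrivial⇒n>1 p)
    prime∤! {suc m} m<p p∣m! with euclidsLemma (suc m) (m !) p-prime p∣m!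
    ... | inj₁ p∣m  = >⇒∤ m<p p∣m
    ... | inj₂ p∣m! = prime∤! (<-trans (n<1+n m) m<p) p∣m!

    prime∣pCk : ∀ {k} → 0 < k → k < p → p ∣ p C k
    prime∣pCk {k} 0<k k<p
      with euclidsLemma (p C k) (k ! * (p ∸ k) !) p-prime (subst (p ∣_) (n!≡nCk*[k!*[n∸k]!] (<⇒≤ k<p)) n∣n!)
    ... | inj₁ p∣pCk           = p∣pCk
    ... | inj₂ p∣k!*[p∸k]! with euclidsLemma (k !) ((p ∸ k) !) p-prime p∣k!*[p∸k]!
    ...   | inj₁ p∣k!     = contradiction p∣k! (prime∤! k<p)
    ...   | inj₂ p∣[p∸k]! = contradiction p∣[p∸k]! (prime∤! (∸-monoʳ-< 0<k (<⇒≤ k<p)))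

    binomialSum≡1[mod-p] : ∀ a {m} → 0 < m → m ≤ p → ∃[ q ] binomialSum p a m ≡ 1 + q * p
    binomialSum≡1[mod-p] a {1}           _ _     = 0 , refl
    binomialSum≡1[mod-p] a {suc (suc m)} _ m+1<p
      with q , eq ← binomialSum≡1[mod-p] a (s≤s z≤n) (≤-trans (n≤1+n _) m+1<p)
         | divides r pCm≡r*p ← prime∣pCk (s≤s z≤n) m+1<p
      = q + r * a ^ suc m , (begin
        binomialSum p a (suc m) + (p C suc m) * a ^ suc m  ≡⟨ cong₂ (λ s c → s + c * a ^ suc m) eq pCm≡r*p ⟩
        1 + q * p + r * p * a ^ suc m                      ≡⟨ collect q p r (a ^ suc m) ⟩
        1 + (q + r * a ^ suc m) * p                        ∎)
      where
      open ≡-Reasoning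
      collect : ∀ q p r b → 1 + q * p + r * p * b ≡ 1 + (q + r * b) * p
      collect = solve-∀

    fermat-ℕ : ∀ a → ∃[ q ] a ^ p ≡ a + q * p
    fermat-ℕ zero    = 0 , 0^n≡0 p
    fermat-ℕ (suc a)
      with q , eq ← binomialSum≡1[mod-p] a (>-nonZero⁻¹ p) ≤-refl
         | q′ , eq′ ← fermat-ℕ a
      = q + q′ , (begin
        suc a ^ p                             ≡⟨ binomial-theorem p a ⟩
        binomialSum p a p + (p C p) * a ^ p   ≡⟨ cong₂ (λ s c → s + c * a ^ p) eq (nCn≡1 p) ⟩
        1 + q * p + 1 * a ^ p                 ≡⟨ cong (λ b → 1 + q * p + 1 * b) eq′ ⟩
        1 + q * p + 1 * (a + q′ * p)          ≡⟨ collect q q′ a p ⟩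
        suc a + (q + q′) * p                  ∎)
      where
      open ≡-Reasoning
      collect : ∀ q q′ a p → 1 + q * p + 1 * (a + q′ * p) ≡ suc a + (q + q′) * p
      collect = solve-∀

module CubesModPrime where

  open import Data.Integer.Base using (ℤ; +_; _+_; _-_; _*_; _^_; _%ℕ_; _/ℕ_)
  open import Data.Integer.Properties using (pos-*; pos-+; *-zeroˡ; abs-*; ^-*-assoc; ^-distribˡ-+-*)
  open import Data.Integer.DivMod using (a≡a%ℕn+[a/ℕn]*n)
  open import Data.Integer.Divisibility.Signed
    using (_∣_; divides; ∣-refl; ∣-trans; ∣ᵤ⇒∣; ∣⇒∣ᵤ; ∣m∣n⇒∣m+n; ∣m∣n⇒∣m-n; ∣m⇒∣m*n; ∣n⇒∣m*n)
  open import Data.Integer.Tactic.RingSolver using (solve-∀)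
  open import Data.Nat.Base as ℕ using (ℕ; zero; suc; NonZero)
  import Data.Nat.Properties as ℕ
  import Data.Nat.DivMod as ℕ
  import Data.Nat.Divisibility as ℕ
  import Data.Nat.Tactic.RingSolver as ℕ-Solver
  open import Data.Nat.Primality using (Prime; euclidsLemma; prime⇒nonZero)
  open import Data.Product.Base using (_×_; _,_)
  open import Data.Sum.Base using (_⊎_; inj₁; inj₂; [_,_])
  open import Function.Base using (id)
  open import Relation.Nullary.Negation using (contradiction)
  open import Relation.Binary.PropositionalEquality using (_≡_; refl; sym; trans; cong; subst; module ≡-Reasoning)
  open Fermat using (fermat-ℕ)

  pos-^ : ∀ a n → + (a ℕ.^ n) ≡ (+ a) ^ n
  pos-^ a zero    = refl
  pos-^ a (suc n) = trans (pos-* a (a ℕ.^ n)) (cong (_*_ (+ a)) (pos-^ a n))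

  x-y∣xⁿ-yⁿ : ∀ x y n → x - y ∣ x ^ n - y ^ n
  x-y∣xⁿ-yⁿ x y zero    = divides (+ 0) (sym (*-zeroˡ (x - y)))
  x-y∣xⁿ-yⁿ x y (suc n) = subst (x - y ∣_) (telescope x y (x ^ n) (y ^ n))
    (∣m∣n⇒∣m+n (∣n⇒∣m*n x (x-y∣xⁿ-yⁿ x y n)) (∣m⇒∣m*n (y ^ n) ∣-refl))
    where
    telescope : ∀ x y u v → x * (u - v) + (x - y) * v ≡ x * u - y * v
    telescope = solve-∀

  private
    cancel : ∀ a b → a + b - a ≡ b
    cancel = solve-∀

  module _ {p : ℕ} (p-prime : Prime p) where

    private instance
      p≢0 = prime⇒nonZero p-prime

    euclid : ∀ i j → + p ∣ i * j → + p ∣ i ⊎ + p ∣ j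
    euclid i j p∣ij with euclidsLemma _ _ p-prime (subst (p ℕ.∣_) (abs-* i j) (∣⇒∣ᵤ p∣ij))
    ... | inj₁ p∣i = inj₁ (∣ᵤ⇒∣ p∣i)
    ... | inj₂ p∣j = inj₂ (∣ᵤ⇒∣ p∣j)

    fermat-pos : ∀ a → + p ∣ (+ a) ^ p - + a
    fermat-pos a with q , eq ← fermat-ℕ p-prime a = divides (+ q) (begin
      (+ a) ^ p - + a            ≡⟨ cong (_- + a) (pos-^ a p) ⟨
      + (a ℕ.^ p) - + a          ≡⟨ cong (λ n → + n - + a) eq ⟩
      + (a ℕ.+ q ℕ.* p) - + a    ≡⟨ cong (_- + a) (trans (pos-+ a _) (cong (_+_ (+ a)) (pos-* q p))) ⟩
      + a + + q * + p - + a      ≡⟨ cancel (+ a) (+ q * + p) ⟩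
      + q * + p                  ∎)
      where open ≡-Reasoning

    fermat : ∀ A → + p ∣ A ^ p - A
    fermat A = subst (+ p ∣_) (regroup (A ^ p) (r ^ p) A r)
      (∣m∣n⇒∣m-n (∣m∣n⇒∣m+n (∣-trans p∣A-r (x-y∣xⁿ-yⁿ A r p)) (fermat-pos (A %ℕ p))) p∣A-r)
      where
      r = + (A %ℕ p)
      p∣A-r : + p ∣ A - r
      p∣A-r = divides (A /ℕ p) (trans (cong (_- r) (a≡a%ℕn+[a/ℕn]*n A p)) (cancel r _))
      regroup : ∀ Aᵖ rᵖ A r → (Aᵖ - rᵖ) + (rᵖ - r) - (A - r) ≡ Aᵖ - A
      regroup = solve-∀

    fermat-iterated : ∀ A → + p ∣ A ^ (p ℕ.+ ℕ.pred p) - A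
    fermat-iterated A = subst (+ p ∣_) (trans (regroup A X) (cong (_- A) (sym A²ᵖ⁻¹≡AXX)))
      (∣m∣n⇒∣m+n (∣m⇒∣m*n X p∣AX-A) p∣AX-A)
      where
      X = A ^ ℕ.pred p
      Aᵖ≡AX : A ^ p ≡ A * X
      Aᵖ≡AX = cong (A ^_) (sym (ℕ.suc-pred p))
      A²ᵖ⁻¹≡AXX : A ^ (p ℕ.+ ℕ.pred p) ≡ A * X * X
      A²ᵖ⁻¹≡AXX = trans (^-distribˡ-+-* A p (ℕ.pred p)) (cong (_* X) Aᵖ≡AX)
      p∣AX-A : + p ∣ A * X - A
      p∣AX-A = subst (λ Aᵖ → + p ∣ Aᵖ - A) Aᵖ≡AX (fermat A)
      regroup : ∀ A X → (A * X - A) * X + (A * X - A) ≡ A * X * X - A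
      regroup = solve-∀

    cube-injective : ∀ {A B} → p ℕ.% 3 ≡ 2 → + p ∣ A ^ 3 - B ^ 3 → + p ∣ A - B
    cube-injective {A} {B} p%3≡2 p∣A³-B³ = subst (+ p ∣_) (regroup A B (cube^e A) (cube^e B))
      (∣m∣n⇒∣m+n (∣m∣n⇒∣m-n (cube-root B) (cube-root A)) (∣-trans p∣A³-B³ (x-y∣xⁿ-yⁿ (A ^ 3) (B ^ 3) e)))
      where
      m = p ℕ./ 3
      e = suc (2 ℕ.* m)
      cube^e : ℤ → ℤ
      cube^e C = (C ^ 3) ^ e
      arith : ∀ m → 2 ℕ.+ m ℕ.* 3 ℕ.+ suc (m ℕ.* 3) ≡ 3 ℕ.* suc (2 ℕ.* m)
      arith = ℕ-Solver.solve-∀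
      2p-1≡3e : p ℕ.+ ℕ.pred p ≡ 3 ℕ.* e
      2p-1≡3e = trans (cong (λ q → q ℕ.+ ℕ.pred q) (trans (ℕ.m≡m%n+[m/n]*n p 3) (cong (ℕ._+ m ℕ.* 3) p%3≡2))) (arith m)
      cube-root : ∀ C → + p ∣ cube^e C - C
      cube-root C = subst (λ k → + p ∣ k - C) (trans (cong (C ^_) 2p-1≡3e) (sym (^-*-assoc C 3 e))) (fermat-iterated C)
      regroup : ∀ A B a b → (b - B) - (a - A) + (a - b) ≡ A - B
      regroup = solve-∀

  norm : ℤ → ℤ → ℤ
  norm x y = x * x + + 3 * (y * y)

  module _ {p : ℕ} (p-prime : Prime p) (p%6≡5 : p ℕ.% 6 ≡ 5) where

    private
      5≤p : 5 ℕ.≤ p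
      5≤p = subst (ℕ._≤ p) p%6≡5 (ℕ.m%n≤m p 6)

      p%3≡2 : p ℕ.% 3 ≡ 2
      p%3≡2 = trans (sym (ℕ.m∣n⇒o%n%m≡o%m 3 6 p (ℕ.divides 2 refl))) (cong (ℕ._% 3) p%6≡5)

      cancel-small : ∀ k .{{_ : NonZero k}} i → k ℕ.< p → + p ∣ + k * i → + p ∣ i
      cancel-small k i k<p p∣ki = [ (λ p∣k → contradiction (∣⇒∣ᵤ p∣k) (ℕ.>⇒∤ k<p)) , id ] (euclid p-prime (+ k) i p∣ki)

    prime∣norm⇒prime∣both : ∀ {x y} → + p ∣ norm x y → + p ∣ x × + p ∣ y
    prime∣norm⇒prime∣both {x} {y} p∣norm = p∣x , p∣y
      where
      -- the right-hand side is (x - y) ^ 3 - (+ 2 * y) ^ 3, unfolded for the ring solver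
      cubes : ∀ x y → (x - + 3 * y) * (x * x + + 3 * (y * y))
                      ≡ (x - y) * ((x - y) * ((x - y) * + 1)) - (+ 2 * y) * ((+ 2 * y) * ((+ 2 * y) * + 1))
      cubes = solve-∀
      difference : ∀ x y → x - y - + 2 * y ≡ x - + 3 * y
      difference = solve-∀
      remainder : ∀ x y → x * x + + 3 * (y * y) - (x - + 3 * y) * (x + + 3 * y) ≡ + 3 * (+ 4 * (y * y))
      remainder = solve-∀
      restore : ∀ x y → x - + 3 * y + + 3 * y ≡ x
      restore = solve-∀
      p∣cubes : + p ∣ (x - y) ^ 3 - (+ 2 * y) ^ 3
      p∣cubes = subst (+ p ∣_) (cubes x y) (∣n⇒∣m*n (x - + 3 * y) p∣norm)
      p∣x-3y : + p ∣ x - + 3 * y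
      p∣x-3y = subst (+ p ∣_) (difference x y) (cube-injective p-prime {x - y} {+ 2 * y} p%3≡2 p∣cubes)
      p∣12y² : + p ∣ + 3 * (+ 4 * (y * y))
      p∣12y² = subst (+ p ∣_) (remainder x y) (∣m∣n⇒∣m-n p∣norm (∣m⇒∣m*n (x + + 3 * y) p∣x-3y))
      p∣y² : + p ∣ y * y
      p∣y² = cancel-small 4 (y * y) 5≤p (cancel-small 3 (+ 4 * (y * y)) (ℕ.<-trans (ℕ.n<1+n 3) 5≤p) p∣12y²)
      p∣y : + p ∣ y
      p∣y = [ id , id ] (euclid p-prime y y p∣y²)
      p∣x : + p ∣ x
      p∣x = subst (+ p ∣_) (restore x y) (∣m∣n⇒∣m+n p∣x-3y (∣n⇒∣m*n (+ 3) p∣y))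

module Descent where

  open import Data.Nat.Base using (ℕ; zero; suc; _<_; _≤_; s≤s; z≤n; _+_; _*_; _^_; >-nonZero)
  open import Data.Nat.Properties using (≤-trans; <-trans; <⇒≢; *-monoʳ-≤; m≤n+m; *-cancelʳ-≡; *-comm; *-identityʳ; *-identityˡ)
  open import Data.Nat.Divisibility using (_∣_; divides; ∣1⇒≡1)
  open import Data.Nat.Tactic.RingSolver using (solve-∀)
  open import Data.Product.Base using (_×_; _,_; ∃₂)
  open import Relation.Binary.PropositionalEquality using (_≡_; _≢_; refl; sym; trans; subst)

  normℕ : ℕ → ℕ → ℕ
  normℕ a b = a * a + 3 * (b * b)

  normℕ≡1 : ∀ a b → normℕ a b ≡ 1 → b ≡ 0 × a ≡ 1
  normℕ≡1 1             zero    _  = refl , refl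
  normℕ≡1 zero          zero    ()
  normℕ≡1 (suc (suc a)) zero    ()
  normℕ≡1 a             (suc b) eq
    with s≤s () ← subst (3 ≤_) eq (≤-trans (*-monoʳ-≤ 3 (s≤s z≤n)) (m≤n+m _ (a * a)))

  normℕ-* : ∀ a b c → normℕ (a * c) (b * c) ≡ normℕ a b * c * c
  normℕ-* = expand
    where
    expand : ∀ a b c → (a * c) * (a * c) + 3 * ((b * c) * (b * c)) ≡ (a * a + 3 * (b * b)) * c * c
    expand = solve-∀

  module _ {p : ℕ} (1<p : 1 < p) (p∣norm⇒p∣both : ∀ a b → p ∣ normℕ a b → p ∣ a × p ∣ b) where

    private instance
      p≢0 = >-nonZero (<-trans (s≤s z≤n) 1<p)

    descend : ∀ a b {n} → normℕ a b ≡ p * (p * n) → ∃₂ λ a′ b′ → a ≡ a′ * p × b ≡ b′ * p × normℕ a′ b′ ≡ n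
    descend a b {n} eq with p∣norm⇒p∣both a b (divides (p * n) (trans eq (*-comm p (p * n))))
    ... | divides a′ refl , divides b′ refl =
      a′ , b′ , refl , refl , *-cancelʳ-≡ _ _ p (*-cancelʳ-≡ _ _ p (trans (sym (normℕ-* a′ b′ p)) (trans eq (regroup p n))))
      where
      regroup : ∀ p n → p * (p * n) ≡ n * p * p
      regroup = solve-∀

    normℕ≢p : ∀ a b → normℕ a b ≢ p
    normℕ≢p a b eq with p∣norm⇒p∣both a b (divides 1 (trans eq (sym (*-identityˡ p))))
    ... | divides a′ refl , divides b′ refl = <⇒≢ 1<p (sym (∣1⇒≡1 (divides (normℕ a′ b′) (sym
      (*-cancelʳ-≡ _ _ p (trans (sym (normℕ-* a′ b′ p)) (trans eq (sym (*-identityˡ p)))))))))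

    normℕ≡p^[k*2] : ∀ k a b → normℕ a b ≡ p ^ (k * 2) → b ≡ 0 × a ≡ p ^ k
    normℕ≡p^[k*2] zero    a b eq = normℕ≡1 a b eq
    normℕ≡p^[k*2] (suc k) a b eq with a′ , b′ , refl , refl , eq′ ← descend a b eq
                                 with refl , refl ← normℕ≡p^[k*2] k a′ b′ eq′ = refl , *-comm (p ^ k) p

    normℕ≢p^[1+k*2] : ∀ k a b → normℕ a b ≢ p ^ suc (k * 2)
    normℕ≢p^[1+k*2] zero    a b eq = normℕ≢p a b (trans eq (*-identityʳ p))
    normℕ≢p^[1+k*2] (suc k) a b eq with a′ , b′ , _ , _ , eq′ ← descend a b eq = normℕ≢p^[1+k*2] k a′ b′ eq′

module Generators where

  open import Defs
  open import Level using (Level)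
  open import Data.Bool.Base using (Bool; T; _∧_)
  open import Data.Bool.Properties using (T-∧)
  open import Data.Integer.Base using (ℤ; +_; -[1+_]; ∣_∣; _+_; _-_; -_; _*_; _%ℕ_; _◃_; sign)
  open import Data.Integer.Properties
    using (+-injective; ⊖-≥; ⊖-<; m-n≡m⊖n; pos-*; pos-+; +◃n≡+n; ∣i∣≡0⇒i≡0) renaming (_≟_ to _≟ℤ_)
  open import Data.Integer.Divisibility.Signed using (∣ᵤ⇒∣; ∣⇒∣ᵤ) renaming (_∣_ to _∣ℤ_)
  open import Data.Integer.Tactic.RingSolver using (solve-∀)
  open import Data.Nat.Base as ℕ using (ℕ; zero; suc; NonZero; s≤s; z≤n)
  import Data.Nat.Properties as ℕ
  open import Data.Nat.Properties using () renaming (_≟_ to _≟ℕ_)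
  import Data.Nat.DivMod as ℕ
  import Data.Nat.Divisibility as ℕ
  import Data.Nat.Tactic.RingSolver as ℕ-Solver
  open import Data.Nat.Primality using (Prime; prime⇒nonZero; prime⇒nonTrivial)
  open import Data.List.Base using (List; []; _∷_; _++_; map; concatMap; filter; filterᵇ; cartesianProduct)
  open import Data.List.Membership.Propositional using (_∈_)
  open import Data.List.Membership.Propositional.Properties using (∈-map⁺; ∈-upTo⁺; ∈-cartesianProduct⁺)
  open import Data.List.Properties using (filter-accept; filter-reject; filter-none)
  open import Data.List.Relation.Unary.All as All using ()
  open import Data.List.Relation.Unary.Any using (here; there)
  open import Data.List.Relation.Unary.AllPairs using (_∷_)
  open import Data.List.Relation.Unary.Unique.Propositional using (Unique)
  import Data.List.Relation.Unary.Unique.Propositional.Properties as Unique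
  import Data.Sign.Properties as Sign
  open import Data.Product.Base using (_×_; _,_; proj₁; proj₂; ∃-syntax)
  open import Data.Sum.Base using (_⊎_; inj₁; inj₂)
  open import Function.Base using (_∘_)
  open import Function.Bundles using (Equivalence)
  open import Relation.Nullary.Decidable using (⌊_⌋; T?; toWitness; fromWitness)
  open import Relation.Nullary.Negation using (¬_; contradiction)
  open import Relation.Unary using (Pred; Decidable)
  open import Relation.Binary.PropositionalEquality using (_≡_; refl; sym; trans; cong; cong₂; subst; module ≡-Reasoning)
  open CubesModPrime using (norm; prime∣norm⇒prime∣both)
  open Descent using (normℕ; normℕ≡p^[k*2]; normℕ≢p^[1+k*2])

  private variable
    ℓ ℓ₁ ℓ₂ : Level
    A : Set ℓ₁
    B : Set ℓ₂

  concatMap-pairs≡cartesianProduct : ∀ (xs : List A) (ys : List B) →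
    concatMap (λ x → map (λ y → (x , y)) ys) xs ≡ cartesianProduct xs ys
  concatMap-pairs≡cartesianProduct []       ys = refl
  concatMap-pairs≡cartesianProduct (x ∷ xs) ys = cong (map (x ,_) ys ++_) (concatMap-pairs≡cartesianProduct xs ys)

  module _ {P : Pred A ℓ} (P? : Decidable P) where

    filter-unique≡[_] : ∀ {xs} z → Unique xs → z ∈ xs → P z → (∀ {w} → P w → w ≡ z) → filter P? xs ≡ z ∷ []
    filter-unique≡[ z ] (z∉xs ∷ _) (here refl) Pz only =
      trans (filter-accept P? Pz) (cong (z ∷_) (filter-none P? (All.map (λ z≢w Pw → z≢w (sym (only Pw))) z∉xs)))
    filter-unique≡[ z ] (x∉xs ∷ unique) (there z∈xs) Pz only =
      trans (filter-reject P? (λ Px → All.lookup x∉xs z∈xs (only Px))) (filter-unique≡[ z ] unique z∈xs Pz only)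

  range-unique : ∀ n → Unique (range n)
  range-unique n = Unique.map⁺ shift-injective (Unique.upTo⁺ _)
    where
    sub-add : ∀ i j → i - j + j ≡ i
    sub-add = solve-∀
    shift-injective : ∀ {k k′} → + k - + n ≡ + k′ - + n → k ≡ k′
    shift-injective {k} {k′} eq = +-injective (begin
      + k               ≡⟨ sub-add (+ k) (+ n) ⟨
      + k - + n + + n   ≡⟨ cong (_+ + n) eq ⟩
      + k′ - + n + + n  ≡⟨ sub-add (+ k′) (+ n) ⟩
      + k′              ∎)
      where open ≡-Reasoning

  ∈-range : ∀ {n x} → ∣ x ∣ ℕ.≤ n → x ∈ range n
  ∈-range {n} {+ m} m≤n = subst (_∈ range n) shift (∈-map⁺ (λ k → + k - + n) (∈-upTo⁺ n+m<2n+1))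
    where
    n+m<2n+1 : n ℕ.+ m ℕ.< suc (2 ℕ.* n)
    n+m<2n+1 = s≤s (ℕ.+-monoʳ-≤ n (ℕ.≤-trans m≤n (ℕ.m≤m+n n 0)))
    shift : + (n ℕ.+ m) - + n ≡ + m
    shift = trans (m-n≡m⊖n (n ℕ.+ m) n) (trans (⊖-≥ (ℕ.m≤m+n n m)) (cong +_ (ℕ.m+n∸m≡n n m)))
  ∈-range {n} { -[1+ m ] } m<n = subst (_∈ range n) shift (∈-map⁺ (λ k → + k - + n) (∈-upTo⁺ n-m-1<2n+1))
    where
    n-m-1<2n+1 : n ℕ.∸ suc m ℕ.< suc (2 ℕ.* n)
    n-m-1<2n+1 = s≤s (ℕ.≤-trans (ℕ.m∸n≤m n (suc m)) (ℕ.m≤m+n n _))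
    shift : + (n ℕ.∸ suc m) - + n ≡ -[1+ m ]
    shift = trans (m-n≡m⊖n (n ℕ.∸ suc m) n)
      (trans (⊖-< (ℕ.∸-monoʳ-< (s≤s z≤n) m<n)) (cong (λ k → - + k) (ℕ.m∸[m∸n]≡n m<n)))

  Normalised : ℤ → ℤ → Set
  Normalised x y = T (normalisedᵇ x y)

  normalised⁺ : ∀ x y → (x + y) %ℕ 2 ≡ 1 → x %ℕ 3 ≡ 1 → Normalised x y
  normalised⁺ x y x+y≡1 x≡1 =
    Equivalence.from (T-∧ {⌊ (x + y) %ℕ 2 ≟ℕ 1 ⌋}) (fromWitness x+y≡1 , fromWitness x≡1)

  normalised⁻ : ∀ x y → Normalised x y → (x + y) %ℕ 2 ≡ 1 × x %ℕ 3 ≡ 1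
  normalised⁻ x y n with t₂ , t₃ ← Equivalence.to (T-∧ {⌊ (x + y) %ℕ 2 ≟ℕ 1 ⌋}) n
    = toWitness {a? = (x + y) %ℕ 2 ≟ℕ 1} t₂ , toWitness {a? = x %ℕ 3 ≟ℕ 1} t₃

  -[1+n]%ℕd : ∀ n d .{{_ : NonZero d}} {r} → suc n ℕ.% d ≡ suc r → -[1+ n ] %ℕ d ≡ d ℕ.∸ suc r
  -[1+n]%ℕd n d eq rewrite eq = refl

  m%n≡r⇒m%d≡r%d : ∀ m {n r} d .{{_ : NonZero n}} .{{_ : NonZero d}} → d ℕ.∣ n → m ℕ.% n ≡ r → m ℕ.% d ≡ r ℕ.% d
  m%n≡r⇒m%d≡r%d m {n} d d∣n eq = trans (sym (ℕ.m∣n⇒o%n%m≡o%m d n m d∣n)) (cong (ℕ._% d) eq)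

  normalised-exists : ∀ M → M ℕ.% 6 ≡ 1 ⊎ M ℕ.% 6 ≡ 5 → ∃[ x ] ∣ x ∣ ≡ M × Normalised x (+ 0)
  normalised-exists M (inj₁ M≡1) = + M , refl , normalised⁺ (+ M) (+ 0)
    (trans (cong (ℕ._% 2) (ℕ.+-identityʳ M)) (m%n≡r⇒m%d≡r%d M 2 (ℕ.divides 3 refl) M≡1))
    (m%n≡r⇒m%d≡r%d M 3 (ℕ.divides 2 refl) M≡1)
  normalised-exists (suc M) (inj₂ M≡5) = -[1+ M ] , refl , normalised⁺ -[1+ M ] (+ 0)
    (-[1+n]%ℕd M 2 (m%n≡r⇒m%d≡r%d (suc M) 2 (ℕ.divides 3 refl) M≡5))
    (-[1+n]%ℕd M 3 (m%n≡r⇒m%d≡r%d (suc M) 3 (ℕ.divides 2 refl) M≡5))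

  opposite-signs : ∀ n → Normalised -[1+ n ] (+ 0) → ¬ Normalised (+ suc n) (+ 0)
  opposite-signs n n⁻ n⁺
    with () ← trans (sym (-[1+n]%ℕd n 3 (proj₂ (normalised⁻ (+ suc n) (+ 0) n⁺)))) (proj₂ (normalised⁻ -[1+ n ] (+ 0) n⁻))

  normalised-unique : ∀ {x x′} → ∣ x ∣ ≡ ∣ x′ ∣ → Normalised x (+ 0) → Normalised x′ (+ 0) → x ≡ x′
  normalised-unique {+ _}       {+ _}       refl _   _    = refl
  normalised-unique { -[1+ _ ]} { -[1+ _ ]} refl _   _    = refl
  normalised-unique {+ _}       { -[1+ n ]} refl x≡1 x′≡1 = contradiction x≡1 (opposite-signs n x′≡1)
  normalised-unique { -[1+ n ]} {+ _}       refl x≡1 x′≡1 = contradiction x′≡1 (opposite-signs n x≡1)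

  i*i≡+∣i∣*∣i∣ : ∀ i → i * i ≡ + (∣ i ∣ ℕ.* ∣ i ∣)
  i*i≡+∣i∣*∣i∣ i = trans (cong (_◃ (∣ i ∣ ℕ.* ∣ i ∣)) (Sign.s*s≡+ (sign i))) (+◃n≡+n _)

  norm≡+normℕ : ∀ x y → norm x y ≡ + normℕ ∣ x ∣ ∣ y ∣
  norm≡+normℕ x y = begin
    x * x + + 3 * (y * y)           ≡⟨ cong₂ (λ u v → u + + 3 * v) (i*i≡+∣i∣*∣i∣ x) (i*i≡+∣i∣*∣i∣ y) ⟩
    + x² + + 3 * + y²               ≡⟨ cong (_+_ (+ x²)) (pos-* 3 y²) ⟨
    + x² + + (3 ℕ.* y²)             ≡⟨ pos-+ x² (3 ℕ.* y²) ⟨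
    + normℕ ∣ x ∣ ∣ y ∣              ∎
    where
    open ≡-Reasoning
    x² = ∣ x ∣ ℕ.* ∣ x ∣
    y² = ∣ y ∣ ℕ.* ∣ y ∣

  isNormGenᵇ : ℕ → ℤ × ℤ → Bool
  isNormGenᵇ n (x , y) = ⌊ norm x y ≟ℤ + n ⌋ ∧ normalisedᵇ x y

  normGens≡filter : ∀ n → normGens n ≡ filterᵇ (isNormGenᵇ n) (cartesianProduct (range n) (range n))
  normGens≡filter n = cong (filterᵇ (isNormGenᵇ n)) (concatMap-pairs≡cartesianProduct (range n) (range n))

  isNormGen⁺ : ∀ n x y → normℕ ∣ x ∣ ∣ y ∣ ≡ n → Normalised x y → T (isNormGenᵇ n (x , y))
  isNormGen⁺ n x y eq n-xy =
    Equivalence.from (T-∧ {⌊ norm x y ≟ℤ + n ⌋}) (fromWitness (trans (norm≡+normℕ x y) (cong +_ eq)) , n-xy)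

  isNormGen⁻ : ∀ n x y → T (isNormGenᵇ n (x , y)) → normℕ ∣ x ∣ ∣ y ∣ ≡ n × Normalised x y
  isNormGen⁻ n x y t with t₁ , n-xy ← Equivalence.to (T-∧ {⌊ norm x y ≟ℤ + n ⌋}) t =
    +-injective (trans (sym (norm≡+normℕ x y)) (toWitness {a? = norm x y ≟ℤ + n} t₁)) , n-xy

  module _ {p : ℕ} (p-prime : Prime p) (p%6≡5 : p ℕ.% 6 ≡ 5) where

    private
      instance
        p≢0 = prime⇒nonZero p-prime

      p^k%6 : ∀ k → p ℕ.^ k ℕ.% 6 ≡ 1 ⊎ p ℕ.^ k ℕ.% 6 ≡ 5
      p^k%6 zero    = inj₁ refl
      p^k%6 (suc k) with p^k%6 k
      ... | inj₁ e = inj₂ (trans (ℕ.%-distribˡ-* p (p ℕ.^ k) 6) (cong₂ (λ u v → (u ℕ.* v) ℕ.% 6) p%6≡5 e))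
      ... | inj₂ e = inj₁ (trans (ℕ.%-distribˡ-* p (p ℕ.^ k) 6) (cong₂ (λ u v → (u ℕ.* v) ℕ.% 6) p%6≡5 e))

      p∣normℕ⇒p∣both : ∀ a b → p ℕ.∣ normℕ a b → p ℕ.∣ a × p ℕ.∣ b
      p∣normℕ⇒p∣both a b p∣n =
        let p∣norm = subst (+ p ∣ℤ_) (sym (norm≡+normℕ (+ a) (+ b))) (∣ᵤ⇒∣ p∣n)
            p∣a , p∣b = prime∣norm⇒prime∣both p-prime p%6≡5 {+ a} {+ b} p∣norm
        in ∣⇒∣ᵤ p∣a , ∣⇒∣ᵤ p∣b

      1<p : 1 ℕ.< p
      1<p = ℕ.nonTrivial⇒n>1 p {{prime⇒nonTrivial p-prime}}

    normGens-even : ∀ k → ∃[ x ] Normalised x (+ 0) × normGens (p ℕ.^ (k ℕ.* 2)) ≡ (x , + 0) ∷ []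
    normGens-even k with x₀ , ∣x₀∣≡M , n-x₀ ← normalised-exists (p ℕ.^ k) (p^k%6 k) =
      x₀ , n-x₀ , trans (normGens≡filter n) (filter-unique≡[_] (T? ∘ isNormGenᵇ n) (x₀ , + 0) unique member is-gen only)
      where
      M = p ℕ.^ k
      n = p ℕ.^ (k ℕ.* 2)
      double : ∀ k → k ℕ.+ k ≡ k ℕ.* 2
      double = ℕ-Solver.solve-∀
      M*M≡n : M ℕ.* M ≡ n
      M*M≡n = trans (sym (ℕ.^-distribˡ-+-* p k k)) (cong (p ℕ.^_) (double k))
      M≤n : M ℕ.≤ n
      M≤n = ℕ.^-monoʳ-≤ p (ℕ.m≤m*n k 2)
      unique : Unique (cartesianProduct (range n) (range n))
      unique = Unique.cartesianProduct⁺ (range-unique n) (range-unique n)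
      member : (x₀ , + 0) ∈ cartesianProduct (range n) (range n)
      member = ∈-cartesianProduct⁺ (∈-range {n} {x₀} (subst (ℕ._≤ n) (sym ∣x₀∣≡M) M≤n)) (∈-range {n} {+ 0} z≤n)
      is-gen : T (isNormGenᵇ n (x₀ , + 0))
      is-gen = isNormGen⁺ n x₀ (+ 0)
        (trans (ℕ.+-identityʳ _) (trans (cong (λ m → m ℕ.* m) ∣x₀∣≡M) M*M≡n)) n-x₀
      only : ∀ {w} → T (isNormGenᵇ n w) → w ≡ (x₀ , + 0)
      only {x , y} t = cong₂ _,_ (normalised-unique (trans ∣x∣≡M (sym ∣x₀∣≡M)) n-x n-x₀) y≡0
        where
        gen : normℕ ∣ x ∣ ∣ y ∣ ≡ n × Normalised x y
        gen = isNormGen⁻ n x y t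
        solution : ∣ y ∣ ≡ 0 × ∣ x ∣ ≡ M
        solution = normℕ≡p^[k*2] 1<p p∣normℕ⇒p∣both k ∣ x ∣ ∣ y ∣ (proj₁ gen)
        y≡0 : y ≡ + 0
        y≡0 = ∣i∣≡0⇒i≡0 (proj₁ solution)
        ∣x∣≡M : ∣ x ∣ ≡ M
        ∣x∣≡M = proj₂ solution
        n-x : Normalised x (+ 0)
        n-x = subst (Normalised x) y≡0 (proj₂ gen)

    normGens-odd : ∀ k → normGens (p ℕ.^ suc (k ℕ.* 2)) ≡ []
    normGens-odd k = trans (normGens≡filter n) (filter-none (T? ∘ isNormGenᵇ n)
      (All.universal (λ (x , y) t → normℕ≢p^[1+k*2] 1<p p∣normℕ⇒p∣both k ∣ x ∣ ∣ y ∣ (proj₁ (isNormGen⁻ n x y t)))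
        (cartesianProduct (range n) (range n))))
      where
      n = p ℕ.^ suc (k ℕ.* 2)

module Parity where

  open import Defs
  open import Data.Integer.Base using (ℤ; +_; ∣_∣; _+_; _-_; -_; _*_; _^_; _/ℕ_)
  open import Data.Integer.DivMod using (a≡a%ℕn+[a/ℕn]*n)
  open import Data.Integer.Tactic.RingSolver using (solve-∀)
  open import Data.Nat.Base using (zero; suc)
  open import Data.Product.Base using (_,_; proj₁; ∃-syntax)
  open import Relation.Binary.PropositionalEquality using (_≡_; refl; sym; trans; cong; cong₂; subst)
  open Generators using (Normalised; normalised⁻)

  Odd : ℤ → Set
  Odd u = ∃[ q ] u ≡ + 1 + q * + 2

  normalised⇒odd : ∀ x y → Normalised x y → Odd (x + y)
  normalised⇒odd x y n-xy = (x + y) /ℕ 2 ,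
    trans (a≡a%ℕn+[a/ℕn]*n (x + y) 2) (cong (λ r → + r + (x + y) /ℕ 2 * + 2) (proj₁ (normalised⁻ x y n-xy)))

  odd-* : ∀ {u v} → Odd u → Odd v → Odd (u * v)
  odd-* (q , refl) (r , refl) = q + r + q * r * + 2 , expand q r
    where
    expand : ∀ q r → (+ 1 + q * + 2) * (+ 1 + r * + 2) ≡ + 1 + (q + r + q * r * + 2) * + 2
    expand = solve-∀

  odd-^ : ∀ {u} → Odd u → ∀ n → Odd (u ^ n)
  odd-^ o zero    = + 0 , refl
  odd-^ o (suc n) = odd-* o (odd-^ o n)

  odd-altℕ : ∀ k → Odd (altℕ k)
  odd-altℕ zero    = + 0 , refl
  odd-altℕ (suc k) with q , eq ← odd-altℕ k = - q - + 1 , trans (cong -_ eq) (negate q)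
    where
    negate : ∀ q → - (+ 1 + q * + 2) ≡ + 1 + (- q - + 1) * + 2
    negate = solve-∀

  ι-* : ∀ u v → ι u *K ι v ≡ ι (u * v)
  ι-* u v = cong₂ mk (re-part u v) (om-part u v)
    where
    re-part : ∀ u v → u * v - + 0 * + 0 ≡ u * v
    re-part = solve-∀
    om-part : ∀ u v → u * + 0 + + 0 * v + + 0 * + 0 ≡ + 0
    om-part = solve-∀

  ι-^ : ∀ u n → ι u ^K n ≡ ι (u ^ n)
  ι-^ u zero    = refl
  ι-^ u (suc n) = trans (cong (ι u *K_) (ι-^ u n)) (ι-* u (u ^ n))

  ι-odd≡1 : ∀ {u} → Odd u → ι u ≡ 1K mod2
  ι-odd≡1 (q , refl) = ι q , cong₂ mk (re-part q) (om-part q)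
    where
    re-part : ∀ q → + 1 + q * + 2 - + 1 ≡ + 2 * q - + 0 * + 0
    re-part = solve-∀
    om-part : ∀ q → + 0 - + 0 ≡ + 2 * + 0 + + 0 * q + + 0 * + 0
    om-part = solve-∀

  c₊-odd≡1 : ∀ x → Odd (x + + 0) → c plus x (+ 0) ≡ 1K mod2
  c₊-odd≡1 x odd = subst (_≡ 1K mod2) (sym (trans (cong (ι sign *K_) (ι-^ (x + + 0) 6)) (ι-* sign _)))
    (ι-odd≡1 (odd-* (odd-altℕ ∣ (x - + 0 - + 1) /ℕ 2 ∣) (odd-^ odd 6)))
    where
    sign = negOnePow ((x - + 0 - + 1) /ℕ 2)

open import Defs
open import Data.Integer.Base using (+_)
import Data.Integer.Properties as ℤ
open import Data.List.Base using ([]; _∷_; map)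
open import Data.Nat.Base using (ℕ; zero; suc; _*_; _^_; _%_)
open import Data.Nat.Primality using (Prime)
open import Data.Nat.Divisibility using (_∣_; divides)
open import Data.Product.Base using (_×_; _,_; ∃-syntax)
open import Data.Sum.Base using (_⊎_; [_,_]′)
open import Relation.Nullary using (¬_)
open import Relation.Nullary.Negation using (contradiction)
open import Relation.Binary.PropositionalEquality using (_≡_; refl; sym; trans; cong; cong₂; subst)
open Generators using (m%n≡r⇒m%d≡r%d; normGens-even; normGens-odd)
open Parity using (normalised⇒odd; c₊-odd≡1)

+K-identityʳ : ∀ u → u +K 0K ≡ u
+K-identityʳ (mk r o) = cong₂ mk (ℤ.+-identityʳ r) (ℤ.+-identityʳ o)

a-single : ∀ s n {x} → normGens n ≡ (x , + 0) ∷ [] → a s n ≡ c s x (+ 0)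
a-single s n {x} gens = trans (cong (λ gs → sumK (map _ gs)) gens) (+K-identityʳ (c s x (+ 0)))

a-empty : ∀ s n → normGens n ≡ [] → a s n ≡ 0K
a-empty s n gens = cong (λ gs → sumK (map _ gs)) gens

2∤⇒≡suc[k*2] : ∀ {j} → ¬ 2 ∣ j → ∃[ k ] j ≡ suc (k * 2)
2∤⇒≡suc[k*2] {zero}        2∤j = contradiction (divides 0 refl) 2∤j
2∤⇒≡suc[k*2] {suc zero}    _   = 0 , refl
2∤⇒≡suc[k*2] {suc (suc j)} 2∤j = let k , j≡1+2k = 2∤⇒≡suc[k*2] 2∤j′ in suc k , cong (λ m → suc (suc m)) j≡1+2k
  where
  2∤j′ : ¬ 2 ∣ j
  2∤j′ (divides q eq) = 2∤j (divides (suc q) (cong (λ m → suc (suc m)) eq))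

module _ {p : ℕ} (p-prime : Prime p) (p%6≡5 : p % 6 ≡ 5) where

  -- On a generator with y = 0 the two characters agree by computation: x - + 0 and x + + 0 are the same term.
  a-even-power : ∀ k → (a plus (p ^ (k * 2)) ≡ a minus (p ^ (k * 2))) × (a plus (p ^ (k * 2)) ≡ 1K mod2)
  a-even-power k with x , n-x , gens ← normGens-even p-prime p%6≡5 k =
    trans (a-single plus n gens) (sym (a-single minus n gens)) ,
    subst (_≡ 1K mod2) (sym (a-single plus n gens)) (c₊-odd≡1 x (normalised⇒odd x (+ 0) n-x))
    where
    n = p ^ (k * 2)

  a-odd-power : ∀ k → (a plus (p ^ suc (k * 2)) ≡ 0K) × (a minus (p ^ suc (k * 2)) ≡ 0K)
  a-odd-power k = a-empty plus n (normGens-odd p-prime p%6≡5 k) , a-empty minus n (normGens-odd p-prime p%6≡5 k)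
    where
    n = p ^ suc (k * 2)

lemma4p1 : (p j : ℕ) → Prime p → (p % 12 ≡ 5 ⊎ p % 12 ≡ 11) →
    (2 ∣ j → (a plus (p ^ j) ≡ a minus (p ^ j)) × (a plus (p ^ j) ≡ 1K mod2))
    × (¬ (2 ∣ j) → (a plus (p ^ j) ≡ 0K) × (a minus (p ^ j) ≡ 0K))
lemma4p1 p j p-prime p%12≡5∨11 =
  (λ { (divides k refl) → a-even-power p-prime p%6≡5 k }) ,
  (λ 2∤j → let k , j≡1+2k = 2∤⇒≡suc[k*2] 2∤j in
    subst (λ j → (a plus (p ^ j) ≡ 0K) × (a minus (p ^ j) ≡ 0K)) (sym j≡1+2k) (a-odd-power p-prime p%6≡5 k))
  where
  p%6≡5 : p % 6 ≡ 5
  p%6≡5 = [ m%n≡r⇒m%d≡r%d p 6 (divides 2 refl) , m%n≡r⇒m%d≡r%d p 6 (divides 2 refl) ]′ p%12≡5∨11
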